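{- Fix any finite sequence $X=x_1,\dots,x_m$ of pairing-heap operations executed on an initially empty collection of pairing heaps, and let $\Phi_0,\dots,\Phi_m$ be the potential defined in the context. If $x_i$ is a Meld, then $a_i+\Phi_i-\Phi_{i-1}\le 0$.
   Context: A pairing heap is a heap-ordered (min-heap) rooted ordered tree. Pairing two trees makes the root with the larger key the new leftmost child of the other root. Make-Heap creates a new single-node heap; Meld pairs two roots; Insert creates a node and pairs it with the root; Decrease-Key cuts a non-root node with its subtree, decreases its key and pairs it with the root; Delete cuts a node and its subtree, performs Extract-Min on that subtree and pairs the result with the root; Extract-Min removes the root, pairs its children left to right in pairs (first with second, third with fourth, ...), then repeatedly pairs the two rightmost remaining trees until one remains. The actual cost $a_i$ of $x_i$ is the number of pairings it performs plus $1$; $n_i$ is the size of the heap $x_i$ acted upon after $x_i$. Binary representation: each node's left child is its leftmost child and its right child is its immediate right sibling. A node is black if it remains in the collection of heaps at the end of $X$, white otherwise. For a node $x$, $s(x)$ is the number of white nodes in the subtree of $x$ in the binary representation (including $x$). A white node is heavy if the number of white nodes in its left binary subtree is at least the number in its right binary subtree, and light otherwise. A node is captured if its parent (in the heap tree) exists and is black. Node potential of a white node $x$: rank potential $18\log_2 s(x)$; plus triple-white potential $0$ if $x$ has an immediate left sibling and an immediate right sibling that are both white, and $6$ otherwise; plus weight potential $0$ if heavy and $6$ if light; plus capture potential $0$ if captured and $6$ otherwise. The node potential of a black node is only its capture potential ($0$ if captured, $6$ otherwise). Each heap with $k$ white nodes has heap potential $8-36\sum_{j=1}^{k}\log_2 j$.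 $\Phi_i$ is the sum of all node potentials and heap potentials in the collection after executing $x_i$ ($\Phi_0=0$). -}

module Defs where

open import Data.Nat.Base using (ℕ; zero; suc; _+_; _*_; _^_; _≤_; _≤ᵇ_; _≡ᵇ_; _!)
open import Data.Bool.Base using (Bool; true; false; if_then_else_; not; _∧_; _∨_)
open import Data.List.Base using (List; []; _∷_)
open import Data.Maybe.Base using (Maybe; just; nothing)
open import Data.Product.Base using (_×_; _,_)

-- Pairing heaps (heap-ordered multiway trees).
-- node label key children ; children listed left to right.
-- Labels identify nodes: the j-th created node (j = 0,1,...) gets label j.

data Tree : Set where
  node : (lbl key : ℕ) → List Tree → Tree

label : Tree → ℕ
label (node l _ _) = l

-- Pairing: the root with the larger key becomes the new leftmost child of
-- the other root.  Tie-breaking convention: on equal keys the FIRST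
-- argument stays the root.
pair : Tree → Tree → Tree
pair (node l₁ k₁ c₁) (node l₂ k₂ c₂) =
  if k₁ ≤ᵇ k₂ then node l₁ k₁ (node l₂ k₂ c₂ ∷ c₁)
              else node l₂ k₂ (node l₁ k₁ c₁ ∷ c₂)

pass1 : List Tree → List Tree × ℕ
pass1 [] = [] , 0
pass1 (t ∷ []) = t ∷ [] , 0
pass1 (a ∷ b ∷ r) with pass1 r
... | r' , c = pair a b ∷ r' , suc c

pass2 : List Tree → Maybe Tree × ℕ
pass2 [] = nothing , 0
pass2 (t ∷ r) with pass2 r
... | nothing , c = just t , c
... | just u , c = just (pair t u) , suc c

combine : List Tree → Maybe Tree × ℕ
combine cs with pass1 cs
... | cs' , c₁ with pass2 cs'
...   | r , c₂ = r , c₁ + c₂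

cutF : ℕ → List Tree → Maybe (List Tree × Tree)
cutF x [] = nothing
cutF x (node l k cs ∷ ts) with l ≡ᵇ x
... | true = just (ts , node l k cs)
... | false with cutF x cs
...   | just (cs' , s) = just (node l k cs' ∷ ts , s)
...   | nothing with cutF x ts
...     | just (ts' , s) = just (node l k cs ∷ ts' , s)
...     | nothing = nothing

cutT : ℕ → Tree → Maybe (Tree × Tree)
cutT x (node l k cs) with cutF x cs
... | just (cs' , s) = just (node l k cs' , s)
... | nothing = nothing

occF : ℕ → List Tree → Bool
occF x [] = false
occF x (node l k cs ∷ ts) = (l ≡ᵇ x) ∨ occF x cs ∨ occF x ts

occT : ℕ → Tree → Bool
occT x t = occF x (t ∷ [])

-- Collections of heaps and operations.
-- A heap is either empty (nothing) or a tree.  Heaps are addressed by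
-- their position in the list.  A state also records the next fresh label.

Heap : Set
Heap = Maybe Tree

record State : Set where
  constructor st
  field
    heaps : List Heap
    fresh : ℕ
open State public

initial : State
initial = st [] 0

data Op : Set where
  makeHeap    : (key : ℕ) → Op
  meld        : (h₁ h₂ : ℕ) → Op
  insert      : (h key : ℕ) → Op
  decreaseKey : (x key : ℕ) → Op
  delete      : (x : ℕ) → Op
  extractMin  : (h : ℕ) → Op

lookupM : List Heap → ℕ → Maybe Heap
lookupM [] _ = nothing
lookupM (h ∷ hs) zero = just h
lookupM (h ∷ hs) (suc n) = lookupM hs n

setAt : List Heap → ℕ → Heap → List Heap
setAt [] _ _ = []
setAt (h ∷ hs) zero v = v ∷ hs
setAt (h ∷ hs) (suc n) v = h ∷ setAt hs n v

removeAt : List Heap → ℕ → List Heap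
removeAt [] _ = []
removeAt (h ∷ hs) zero = hs
removeAt (h ∷ hs) (suc n) = h ∷ removeAt hs n

snoc : List Heap → Heap → List Heap
snoc [] v = v ∷ []
snoc (h ∷ hs) v = h ∷ snoc hs v

modifyContaining : ℕ → (Tree → Maybe (Heap × ℕ)) → List Heap → Maybe (List Heap × ℕ)
modifyContaining x f [] = nothing
modifyContaining x f (nothing ∷ hs) with modifyContaining x f hs
... | just (hs' , c) = just (nothing ∷ hs' , c)
... | nothing = nothing
modifyContaining x f (just t ∷ hs) with occT x t
... | true with f t
...   | just (r , c) = just (r ∷ hs , c)
...   | nothing = nothing
modifyContaining x f (just t ∷ hs) | false with modifyContaining x f hs
...   | just (hs' , c) = just (just t ∷ hs' , c)
...   | nothing = nothing

decTree : ℕ → ℕ → Tree → Maybe (Heap × ℕ)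
decTree x k (node l k₀ cs) with l ≡ᵇ x
... | true = if k ≤ᵇ k₀ then just (just (node l k cs) , 0) else nothing
... | false with cutT x (node l k₀ cs)
...   | nothing = nothing
...   | just (t' , node xl xk xcs) =
          if k ≤ᵇ xk then just (just (pair t' (node xl k xcs)) , 1) else nothing

delTree : ℕ → Tree → Maybe (Heap × ℕ)
delTree x (node l k cs) with l ≡ᵇ x
... | true = just (combine cs)
... | false with cutT x (node l k cs)
...   | nothing = nothing
...   | just (t' , node _ _ xcs) with combine xcs
...     | nothing , c = just (just t' , c)
...     | just u , c = just (just (pair t' u) , suc c)

-- One operation: new state and actual cost (number of pairings + 1).
-- nothing = the operation is not applicable.
step : State → Op → Maybe (State × ℕ)
step (st hs n) (makeHeap k) = just (st (snoc hs (just (node n k []))) (suc n) , 1)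
step (st hs n) (meld i j) with i ≡ᵇ j | lookupM hs i | lookupM hs j
... | false | just h₁ | just h₂ = just (st (removeAt (setAt hs i (m h₁ h₂)) j) n , suc (c h₁ h₂))
  where
    m : Heap → Heap → Heap
    m (just t₁) (just t₂) = just (pair t₁ t₂)
    m nothing h = h
    m h nothing = h
    c : Heap → Heap → ℕ
    c (just _) (just _) = 1
    c _ _ = 0
... | _ | _ | _ = nothing
step (st hs n) (insert i k) with lookupM hs i
... | just (just t) = just (st (setAt hs i (just (pair t (node n k [])))) (suc n) , 2)
... | just nothing = just (st (setAt hs i (just (node n k []))) (suc n) , 1)
... | nothing = nothing
step (st hs n) (decreaseKey x k) with modifyContaining x (decTree x k) hs
... | just (hs' , c) = just (st hs' n , suc c)
... | nothing = nothing
step (st hs n) (delete x) with modifyContaining x (delTree x) hs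
... | just (hs' , c) = just (st hs' n , suc c)
... | nothing = nothing
step (st hs n) (extractMin i) with lookupM hs i
... | just (just (node _ _ cs)) with combine cs
...   | r , c = just (st (setAt hs i r) n , suc c)
step (st hs n) (extractMin i) | _ = nothing

run : State → List Op → Maybe State
run s [] = just s
run s (o ∷ os) with step s o
... | just (s' , _) = run s' os
... | nothing = nothing

-- Since there are no real numbers, a potential value is represented exactly
-- by a triple (int , num , den) standing for the real number
--      int + 18 · log₂ num − 18 · log₂ den      (num, den ≥ 1).

record Pot : Set where
  constructor pot
  field
    int num den : ℕ

_⊕_ : Pot → Pot → Pot
pot i₁ n₁ d₁ ⊕ pot i₂ n₂ d₂ = pot (i₁ + i₂) (n₁ * n₂) (d₁ * d₂)

addInt : ℕ → Pot → Pot
addInt a (pot i n d) = pot (a + i) n d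

-- p ⊑ q  iff  (real value of p) ≤ (real value of q):
--   i₁ + 18 log₂ n₁ − 18 log₂ d₁ ≤ i₂ + 18 log₂ n₂ − 18 log₂ d₂
--   ⟺ i₁ + 18 log₂ (n₁ d₂) ≤ i₂ + 18 log₂ (n₂ d₁)
--   ⟺ 2^i₁ (n₁ d₂)^18 ≤ 2^i₂ (n₂ d₁)^18.
_⊑_ : Pot → Pot → Set
pot i₁ n₁ d₁ ⊑ pot i₂ n₂ d₂ = 2 ^ i₁ * (n₁ * d₂) ^ 18 ≤ 2 ^ i₂ * (n₂ * d₁) ^ 18

wcF : (ℕ → Bool) → List Tree → ℕ
wcF w [] = 0
wcF w (node l k cs ∷ ts) = (if w l then 1 else 0) + wcF w cs + wcF w ts

isWhiteM : (ℕ → Bool) → Maybe ℕ → Bool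
isWhiteM w nothing = false
isWhiteM w (just y) = w y

-- Node potentials of a forest (a list of siblings, left to right).
-- parent: label of the heap-parent (nothing for roots);
-- left: label of the immediate left sibling of the first tree in the list.
-- In the binary representation, the subtree of x consists of x, its
-- children forest (left binary subtree) and its right siblings with their
-- subtrees (right binary subtree).
nodePotF : (ℕ → Bool) → (parent left : Maybe ℕ) → List Tree → Pot
nodePotF w p lft [] = pot 0 1 1
nodePotF w p lft (node l k cs ∷ ts) =
  own ⊕ (nodePotF w (just l) nothing cs ⊕ nodePotF w p (just l) ts)
  where
    rgt : Maybe ℕ
    rgt = rgtOf ts
      where
        rgtOf : List Tree → Maybe ℕ
        rgtOf [] = nothing
        rgtOf (node r _ _ ∷ _) = just r
    captured : Bool
    captured = isWhiteM (λ y → not (w y)) p   -- parent exists and is black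
    capP : ℕ
    capP = if captured then 0 else 6
    triP : ℕ
    triP = if isWhiteM w lft ∧ isWhiteM w rgt then 0 else 6
    heavy : Bool
    heavy = wcF w ts ≤ᵇ wcF w cs
    wtP : ℕ
    wtP = if heavy then 0 else 6
    s : ℕ
    s = wcF w (node l k cs ∷ ts)
    own : Pot
    own = if w l then pot (triP + wtP + capP) s 1 else pot capP 1 1

-- heap potential 8 − 36 Σ_{j=1}^{k} log₂ j = 8 − 18 log₂ ((k!)²)
heapPot : (ℕ → Bool) → Heap → Pot
heapPot w nothing = pot 8 1 1
heapPot w (just t) =
  pot 8 1 ((wcF w (t ∷ []) !) * (wcF w (t ∷ []) !)) ⊕ nodePotF w nothing nothing (t ∷ [])

Φ : (ℕ → Bool) → State → Pot
Φ w (st [] n) = pot 0 1 1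
Φ w (st (h ∷ hs) n) = heapPot w h ⊕ Φ w (st hs n)

whiteIn : State → ℕ → Bool
whiteIn (st hs _) x = not (occH hs)
  where
    occH : List Heap → Bool
    occH [] = false
    occH (nothing ∷ r) = occH r
    occH (just t ∷ r) = occT x t ∨ occH r

-- Potentials combine additively, over the heaps of the collection and over the nodes of
-- each heap, so a Meld only affects the two heaps it touches.  If one of them is empty,
-- its heap potential 8 disappears and pays for the cost 1.  Otherwise the root B is linked
-- below the root A at cost 2, and the integer parts balance exactly: one heap potential 8
-- disappears, while the weight and capture potentials of B rise by at most 6 in total.
-- The old leftmost child of A gains a left sibling, which can only lower its triple-white
-- potential; every other node keeps its potential except for the ranks of A and B.  With
-- K_A, K_B, K the white counts of the two heaps and of the linked one, a and b those
-- strictly below A and B, and s ≤ K the rank of B after linking, the ranks of white A and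
-- B grow by 18 log₂ (K / K_A) and 18 log₂ (s / K_B).  This is paid for by the drop
-- 36 log₂ (K! / (K_A! K_B!)) of the heap potential, because K · a! · K_B! ≤ K! when
-- K = 1 + a + K_B, and symmetrically K · b! · K_A! ≤ K!.
module Submission where

open import Defs
open import Data.List.Base using (List; _++_; _∷_; [])
open import Data.Maybe.Base using (just)
open import Data.Nat.Base using (ℕ)
open import Data.Product.Base using (_,_)
open import Relation.Binary.PropositionalEquality using (_≡_)

import Algebra.Solver.CommutativeMonoid
open import Algebra.Bundles using (CommutativeMonoid)
open import Algebra.Structures using (IsCommutativeMonoid)
open import Data.Bool.Base using (Bool; true; false; if_then_else_; _∧_; not)
open import Data.Maybe.Base using (nothing)
open import Data.Nat.Base
open import Data.Nat.Properties
open import Data.Nat.Solver using (module +-*-Solver)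
open import Data.Product.Base using (Σ; _×_)
open import Relation.Binary.PropositionalEquality

ε : Pot
ε = pot 0 1 1

pot-cong : ∀ {i j n m d e} → i ≡ j → n ≡ m → d ≡ e → pot i n d ≡ pot j m e
pot-cong refl refl refl = refl

⊕-assoc : ∀ p q r → (p ⊕ q) ⊕ r ≡ p ⊕ (q ⊕ r)
⊕-assoc (pot i n d) (pot j m e) (pot k o f) = pot-cong (+-assoc i j k) (*-assoc n m o) (*-assoc d e f)

⊕-comm : ∀ p q → p ⊕ q ≡ q ⊕ p
⊕-comm (pot i n d) (pot j m e) = pot-cong (+-comm i j) (*-comm n m) (*-comm d e)

⊕-identityˡ : ∀ p → ε ⊕ p ≡ p
⊕-identityˡ (pot i n d) = pot-cong refl (*-identityˡ n) (*-identityˡ d)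

⊕-isCommutativeMonoid : IsCommutativeMonoid _≡_ _⊕_ ε
⊕-isCommutativeMonoid = record
  { isMonoid = record
    { isSemigroup = record
      { isMagma = record { isEquivalence = isEquivalence ; ∙-cong = cong₂ _⊕_ }
      ; assoc = ⊕-assoc
      }
    ; identity = ⊕-identityˡ , λ p → trans (⊕-comm p ε) (⊕-identityˡ p)
    }
  ; comm = ⊕-comm
  }

⊕-commutativeMonoid : CommutativeMonoid _ _
⊕-commutativeMonoid = record { isCommutativeMonoid = ⊕-isCommutativeMonoid }

module ⊕-Solver = Algebra.Solver.CommutativeMonoid ⊕-commutativeMonoid
open ⊕-Solver using (_⊜_) renaming (_⊕_ to _⊞_; id to ∅)

⊕-exchange : ∀ p q r → p ⊕ (q ⊕ r) ≡ q ⊕ (p ⊕ r)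
⊕-exchange = ⊕-Solver.solve 3 (λ p q r → p ⊞ (q ⊞ r) ⊜ q ⊞ (p ⊞ r)) refl

addInt-≡ : ∀ a p → addInt a p ≡ pot a 1 1 ⊕ p
addInt-≡ a (pot i n d) = pot-cong refl (sym (*-identityˡ n)) (sym (*-identityˡ d))

-- p ⊑ q unfolds to  weight p (den q) ≤ weight q (den p).
weight : Pot → ℕ → ℕ
weight (pot i n _) e = 2 ^ i * (n * e) ^ 18

weight-⊕ : ∀ p q e f → weight (p ⊕ q) (e * f) ≡ weight p e * weight q f
weight-⊕ (pot i n _) (pot j m _) e f rewrite ^-distribˡ-+-* 2 i j =
  solve 6 (λ x y n m e f → x :* y :* (n :* m :* (e :* f)) :^ 18 := x :* (n :* e) :^ 18 :* (y :* (m :* f) :^ 18))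
    refl (2 ^ i) (2 ^ j) n m e f
  where open +-*-Solver

-- _⊑_ computes to an inequality of naturals, from which Agda cannot recover the two
-- potentials; this wrapper keeps them visible to unification.
record _≼_ (p q : Pot) : Set where
  constructor ≼-wrap
  field ≼-unwrap : p ⊑ q
open _≼_

≼-intro : ∀ {i n d j m e} → i ≤ j → n * e ≤ m * d → pot i n d ≼ pot j m e
≼-intro i≤j ne≤md = ≼-wrap (*-mono-≤ (^-monoʳ-≤ 2 i≤j) (^-monoˡ-≤ 18 ne≤md))

≼-refl : ∀ {p} → p ≼ p
≼-refl = ≼-wrap ≤-refl

≼-respʳ : ∀ {p q q′} → q ≡ q′ → p ≼ q → p ≼ q′
≼-respʳ refl p≼q = p≼q

⊕-mono-≼ : ∀ {p₁ p₂ q₁ q₂} → p₁ ≼ q₁ → p₂ ≼ q₂ → (p₁ ⊕ p₂) ≼ (q₁ ⊕ q₂)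
⊕-mono-≼ {p₁} {p₂} {q₁} {q₂} (≼-wrap le₁) (≼-wrap le₂) = ≼-wrap (begin
  weight (p₁ ⊕ p₂) (Pot.den q₁ * Pot.den q₂)       ≡⟨ weight-⊕ p₁ p₂ _ _ ⟩
  weight p₁ (Pot.den q₁) * weight p₂ (Pot.den q₂)  ≤⟨ *-mono-≤ le₁ le₂ ⟩
  weight q₁ (Pot.den p₁) * weight q₂ (Pot.den p₂)  ≡⟨ weight-⊕ q₁ q₂ _ _ ⟨
  weight (q₁ ⊕ q₂) (Pot.den p₁ * Pot.den p₂)       ∎)
  where open ≤-Reasoning

const-⊕-mono-≼ : ∀ {a b} p → a ≤ b → (pot a 1 1 ⊕ p) ≼ (pot b 1 1 ⊕ p)
const-⊕-mono-≼ {a} {b} p a≤b = ⊕-mono-≼ a≼b (≼-refl {p})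
  where
    a≼b : pot a 1 1 ≼ pot b 1 1
    a≼b = ≼-intro a≤b ≤-refl

bit : Bool → ℕ
bit u = if u then 1 else 0

m!*n!≤[m+n]! : ∀ m n → m ! * n ! ≤ (m + n) !
m!*n!≤[m+n]! zero    n = ≤-reflexive (*-identityˡ (n !))
m!*n!≤[m+n]! (suc m) n = begin
  suc m * m ! * n !        ≡⟨ *-assoc (suc m) (m !) (n !) ⟩
  suc m * (m ! * n !)      ≤⟨ *-mono-≤ (s≤s (m≤m+n m n)) (m!*n!≤[m+n]! m n) ⟩
  suc (m + n) * (m + n) !  ∎
  where open ≤-Reasoning

[b+n]!≡[b+n]^b*n! : ∀ u n → (bit u + n) ! ≡ (bit u + n) ^ bit u * n !
[b+n]!≡[b+n]^b*n! false n = sym (*-identityˡ (n !))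
[b+n]!≡[b+n]^b*n! true  n = cong (_* n !) (sym (*-identityʳ (suc n)))

K^b*m!*n!≤K! : ∀ u m n {K} → K ≡ bit u + m + n → K ^ bit u * (m ! * n !) ≤ K !
K^b*m!*n!≤K! false m n refl = ≤-trans (≤-reflexive (*-identityˡ _)) (m!*n!≤[m+n]! m n)
K^b*m!*n!≤K! true  m n refl rewrite *-identityʳ (m + n) = *-monoʳ-≤ (suc (m + n)) (m!*n!≤[m+n]! m n)

link-factorial-bound : ∀ uA uB {a b KA KB K s} →
  KA ≡ bit uA + a → KB ≡ bit uB + b → K ≡ KA + KB → s ≤ K →
  (K ^ bit uA * s ^ bit uB) * ((KA ! * KA !) * (KB ! * KB !)) ≤ (KA ^ bit uA * KB ^ bit uB) * (K ! * K !)
link-factorial-bound uA uB {a} {b} {KA} {KB} {K} {s} refl refl refl s≤K = begin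
  (K ^ α * s ^ β) * ((KA ! * KA !) * (KB ! * KB !))
    ≤⟨ *-monoˡ-≤ _ (*-monoʳ-≤ (K ^ α) (^-monoˡ-≤ β s≤K)) ⟩
  (K ^ α * K ^ β) * ((KA ! * KA !) * (KB ! * KB !))
    ≡⟨ cong₂ (λ x y → (K ^ α * K ^ β) * ((x * KA !) * (y * KB !)))
             ([b+n]!≡[b+n]^b*n! uA a) ([b+n]!≡[b+n]^b*n! uB b) ⟩
  (K ^ α * K ^ β) * ((KA ^ α * a ! * KA !) * (KB ^ β * b ! * KB !))
    ≡⟨ solve 8 (λ Kα Kβ Aα Bβ fa fb FA FB → (Kα :* Kβ) :* ((Aα :* fa :* FA) :* (Bβ :* fb :* FB))
                                        := (Aα :* Bβ) :* ((Kα :* (fa :* FB)) :* (Kβ :* (fb :* FA))))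
               refl (K ^ α) (K ^ β) (KA ^ α) (KB ^ β) (a !) (b !) (KA !) (KB !) ⟩
  (KA ^ α * KB ^ β) * ((K ^ α * (a ! * KB !)) * (K ^ β * (b ! * KA !)))
    ≤⟨ *-monoʳ-≤ (KA ^ α * KB ^ β)
                 (*-mono-≤ (K^b*m!*n!≤K! uA a KB refl) (K^b*m!*n!≤K! uB b KA (+-comm KA KB))) ⟩
  (KA ^ α * KB ^ β) * (K ! * K !)
    ∎
  where
    open ≤-Reasoning
    open +-*-Solver
    α = bit uA
    β = bit uB

0or6≤6 : ∀ b → (if b then 0 else 6) ≤ 6
0or6≤6 true  = z≤n
0or6≤6 false = ≤-refl

0or6+≤6+ : ∀ b {x y z} → (if b then 0 else 6) + x + y + z ≤ 6 + x + y + z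
0or6+≤6+ b {x} {y} {z} = +-monoˡ-≤ z (+-monoˡ-≤ y (+-monoˡ-≤ x (0or6≤6 b)))

-- The triple-white potential depends on the right sibling, which only appears once the
-- list is split.
nodePotF-leftSibling-≼ : ∀ w p l ts → nodePotF w p (just l) ts ≼ nodePotF w p nothing ts
nodePotF-leftSibling-≼ w p l []                 = ≼-refl
nodePotF-leftSibling-≼ w p l (node x k cs ∷ ts) with w x
nodePotF-leftSibling-≼ w p l (node x k cs ∷ [])                 | true = ≼-intro (0or6+≤6+ (w l ∧ false)) ≤-refl
nodePotF-leftSibling-≼ w p l (node x k cs ∷ node r k′ cs′ ∷ ts) | true = ≼-intro (0or6+≤6+ (w l ∧ w r)) ≤-refl
... | false = ≼-refl

-- The term `own` of nodePotF, with its triple-white, weight and capture potentials.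
nodeOwn : Bool → (tri wt cap size : ℕ) → Pot
nodeOwn u tri wt cap s = if u then pot (tri + wt + cap) s 1 else pot cap 1 1

ownInt : Bool → (tri wt cap : ℕ) → ℕ
ownInt u tri wt cap = if u then tri + wt + cap else cap

nodeOwn-≡ : ∀ u tri wt cap s → nodeOwn u tri wt cap s ≡ pot (ownInt u tri wt cap) (s ^ bit u) 1
nodeOwn-≡ false tri wt cap s = refl
nodeOwn-≡ true  tri wt cap s = pot-cong refl (sym (*-identityʳ s)) refl

ownInt-bound : ∀ u {wt cap} → wt ≤ 6 → cap ≤ 6 → ownInt u 6 wt cap ≤ 6 + ownInt u 6 0 6
ownInt-bound true  wt≤6 cap≤6 = +-mono-≤ (+-monoʳ-≤ 6 wt≤6) cap≤6
ownInt-bound false wt≤6 cap≤6 = ≤-trans cap≤6 (m≤n+m 6 6)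

link-local-≼ : ∀ uA uB {a b KA KB K s wt cap} →
  KA ≡ bit uA + a → KB ≡ bit uB + b → K ≡ KA + KB → s ≤ K → wt ≤ 6 → cap ≤ 6 →
  (pot 2 1 1 ⊕ (pot 8 1 (K ! * K !) ⊕ (nodeOwn uA 6 0 6 K ⊕ nodeOwn uB 6 wt cap s)))
  ≼ ((pot 8 1 (KA ! * KA !) ⊕ nodeOwn uA 6 0 6 KA) ⊕ (pot 8 1 (KB ! * KB !) ⊕ nodeOwn uB 6 0 6 KB))
link-local-≼ uA uB {KA = KA} {KB = KB} {K = K} {s = s} {wt = wt} {cap = cap} eA eB eK s≤K wt≤6 cap≤6
  rewrite nodeOwn-≡ uA 6 0 6 K | nodeOwn-≡ uB 6 wt cap s | nodeOwn-≡ uA 6 0 6 KA | nodeOwn-≡ uB 6 0 6 KB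
  = ≼-intro int≤ num≤
  where
    open +-*-Solver
    iA = ownInt uA 6 0 6
    int≤ : 2 + (8 + (iA + ownInt uB 6 wt cap)) ≤ (8 + iA) + (8 + ownInt uB 6 0 6)
    int≤ = ≤-trans
      (≤-reflexive (solve 2 (λ x y → con 2 :+ (con 8 :+ (x :+ y)) := con 8 :+ x :+ (con 2 :+ y)) refl iA (ownInt uB 6 wt cap)))
      (+-monoʳ-≤ (8 + iA) (+-monoʳ-≤ 2 (ownInt-bound uB wt≤6 cap≤6)))
    num≤ = subst₂ _≤_
      (solve 4 (λ n FA FB F → n :* (FA :* FB) := con 1 :* (con 1 :* n) :* (FA :* con 1 :* (FB :* con 1))) refl
        (K ^ bit uA * s ^ bit uB) (KA ! * KA !) (KB ! * KB !) (K ! * K !))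
      (solve 3 (λ m₁ m₂ F → m₁ :* m₂ :* F := con 1 :* m₁ :* (con 1 :* m₂) :* (con 1 :* (F :* con 1))) refl
        (KA ^ bit uA) (KB ^ bit uB) (K ! * K !))
      (link-factorial-bound uA uB eA eB eK s≤K)

link-≼ : ∀ w lA kA lB kB cA cB →
  (pot 2 1 1 ⊕ heapPot w (just (node lA kA (node lB kB cB ∷ cA))))
  ≼ (heapPot w (just (node lA kA cA)) ⊕ heapPot w (just (node lB kB cB)))
link-≼ w lA kA lB kB cA cB =
  subst₂ _≼_ lhs-≡ rhs-≡
    (⊕-mono-≼ (link-local-≼ (w lA) (w lB) (+-identityʳ (bit (w lA) + a)) (+-identityʳ (bit (w lB) + b))
                             K≡KA+KB s≤K (0or6≤6 (a ≤ᵇ b)) (0or6≤6 (not (w lA))))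
              (⊕-mono-≼ (≼-refl {X}) (nodePotF-leftSibling-≼ w (just lA) lB cA)))
  where
    a  = wcF w cA
    b  = wcF w cB
    KA = wcF w (node lA kA cA ∷ [])
    KB = wcF w (node lB kB cB ∷ [])
    s  = wcF w (node lB kB cB ∷ cA)
    K  = wcF w (node lA kA (node lB kB cB ∷ cA) ∷ [])
    X  = nodePotF w (just lB) nothing cB
    Y  = nodePotF w (just lA) nothing cA
    Y′ = nodePotF w (just lA) (just lB) cA
    K≡KA+KB : K ≡ KA + KB
    K≡KA+KB = solve 4 (λ u v a b → u :+ (v :+ b :+ a) :+ con 0 := u :+ a :+ con 0 :+ (v :+ b :+ con 0)) refl
      (bit (w lA)) (bit (w lB)) a b
      where open +-*-Solver
    s≤K : s ≤ K
    s≤K = ≤-trans (m≤n+m s (bit (w lA))) (m≤m+n _ 0)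
    heap = λ n → pot 8 1 (n ! * n !)
    root = λ u → nodeOwn u 6 0 6
    linkedB = nodeOwn (w lB) 6 (if a ≤ᵇ b then 0 else 6) (if not (w lA) then 0 else 6) s
    lhs-≡ = ⊕-Solver.solve 6
      (λ c F a b x y → (c ⊞ (F ⊞ (a ⊞ b))) ⊞ (x ⊞ y) ⊜ c ⊞ (F ⊞ (a ⊞ ((b ⊞ (x ⊞ y)) ⊞ ∅)))) refl
      (pot 2 1 1) (heap K) (root (w lA) K) linkedB X Y′
    rhs-≡ = ⊕-Solver.solve 6
      (λ FA a FB b x y → ((FA ⊞ a) ⊞ (FB ⊞ b)) ⊞ (x ⊞ y) ⊜ (FA ⊞ (a ⊞ (y ⊞ ∅))) ⊞ (FB ⊞ (b ⊞ (x ⊞ ∅)))) refl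
      (heap KA) (root (w lA) KA) (heap KB) (root (w lB) KB) X Y

pair-≼ : ∀ w t₁ t₂ → (pot 2 1 1 ⊕ heapPot w (just (pair t₁ t₂))) ≼ (heapPot w (just t₁) ⊕ heapPot w (just t₂))
pair-≼ w (node l₁ k₁ c₁) (node l₂ k₂ c₂) with k₁ ≤ᵇ k₂
... | true  = link-≼ w l₁ k₁ l₂ k₂ c₁ c₂
... | false = ≼-respʳ (⊕-comm (heapPot w (just (node l₂ k₂ c₂))) _) (link-≼ w l₂ k₂ l₁ k₁ c₂ c₁)

Φ-removeAt : ∀ w hs n j {y} → lookupM hs j ≡ just y →
             Φ w (st hs n) ≡ heapPot w y ⊕ Φ w (st (removeAt hs j) n)
Φ-removeAt w (h ∷ hs) n zero    refl = refl
Φ-removeAt w (h ∷ hs) n (suc j) {y} e =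
  trans (cong (heapPot w h ⊕_) (Φ-removeAt w hs n j e)) (⊕-exchange (heapPot w h) (heapPot w y) _)

Φ-setAt : ∀ w hs n i M {x} → lookupM hs i ≡ just x →
          Φ w (st (setAt hs i M) n) ≡ heapPot w M ⊕ Φ w (st (removeAt hs i) n)
Φ-setAt w (h ∷ hs) n zero    M refl = refl
Φ-setAt w (h ∷ hs) n (suc i) M e    =
  trans (cong (heapPot w h ⊕_) (Φ-setAt w hs n i M e)) (⊕-exchange (heapPot w h) (heapPot w M) _)

Φ-meld : ∀ w hs n i j M {x y} → (i ≡ᵇ j) ≡ false → lookupM hs i ≡ just x → lookupM hs j ≡ just y →
         Σ Pot λ R → Φ w (st hs n) ≡ (heapPot w x ⊕ heapPot w y) ⊕ R
                   × Φ w (st (removeAt (setAt hs i M) j) n) ≡ heapPot w M ⊕ R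
Φ-meld w (h ∷ hs) n zero    zero    M () _ _
Φ-meld w (h ∷ hs) n zero    (suc j) M {y = y} _ refl e =
  _ , trans (cong (heapPot w h ⊕_) (Φ-removeAt w hs n j e))
            (⊕-Solver.solve 3 (λ x y r → x ⊞ (y ⊞ r) ⊜ (x ⊞ y) ⊞ r) refl (heapPot w h) (heapPot w y) _)
    , refl
Φ-meld w (h ∷ hs) n (suc i) zero    M {x} _ e refl =
  _ , trans (cong (heapPot w h ⊕_) (Φ-removeAt w hs n i e))
            (⊕-Solver.solve 3 (λ y x r → y ⊞ (x ⊞ r) ⊜ (x ⊞ y) ⊞ r) refl (heapPot w h) (heapPot w x) _)
    , Φ-setAt w hs n i M e
Φ-meld w (h ∷ hs) n (suc i) (suc j) M {x} {y} i≢j eˣ eʸ with Φ-meld w hs n i j M i≢j eˣ eʸ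
... | R , old , new =
  heapPot w h ⊕ R
  , trans (cong (heapPot w h ⊕_) old)
          (⊕-Solver.solve 4 (λ h x y r → h ⊞ ((x ⊞ y) ⊞ r) ⊜ (x ⊞ y) ⊞ (h ⊞ r)) refl
                            (heapPot w h) (heapPot w x) (heapPot w y) R)
  , trans (cong (heapPot w h ⊕_) new) (⊕-exchange (heapPot w h) (heapPot w M) R)

meld-≼ : ∀ w hs n i j M {x y a} → (i ≡ᵇ j) ≡ false → lookupM hs i ≡ just x → lookupM hs j ≡ just y →
         (pot a 1 1 ⊕ heapPot w M) ≼ (heapPot w x ⊕ heapPot w y) →
         addInt a (Φ w (st (removeAt (setAt hs i M) j) n)) ≼ Φ w (st hs n)
meld-≼ w hs n i j M {a = a} i≢j eˣ eʸ local with Φ-meld w hs n i j M i≢j eˣ eʸ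
... | R , old , new = subst₂ _≼_ charge (sym old) (⊕-mono-≼ local (≼-refl {R}))
  where
    Φ′ = Φ w (st (removeAt (setAt hs i M) j) n)
    charge : (pot a 1 1 ⊕ heapPot w M) ⊕ R ≡ addInt a Φ′
    charge = begin
      (pot a 1 1 ⊕ heapPot w M) ⊕ R  ≡⟨ ⊕-assoc (pot a 1 1) (heapPot w M) R ⟩
      pot a 1 1 ⊕ (heapPot w M ⊕ R)  ≡⟨ cong (pot a 1 1 ⊕_) new ⟨
      pot a 1 1 ⊕ Φ′                 ≡⟨ addInt-≡ a Φ′ ⟨
      addInt a Φ′                    ∎
      where open ≡-Reasoning

step-meld-≼ : ∀ w hs n i j {s₁ a} → step (st hs n) (meld i j) ≡ just (s₁ , a) → addInt a (Φ w s₁) ≼ Φ w (st hs n)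
step-meld-≼ w hs n i j eq with i ≡ᵇ j in i≢j | lookupM hs i in eˣ | lookupM hs j in eʸ
step-meld-≼ w hs n i j () | true  | _ | _
step-meld-≼ w hs n i j () | false | nothing | _
step-meld-≼ w hs n i j () | false | just _  | nothing
step-meld-≼ w hs n i j refl | false | just nothing | just y =
  meld-≼ w hs n i j y i≢j eˣ eʸ (const-⊕-mono-≼ {1} {8} (heapPot w y) (s≤s z≤n))
step-meld-≼ w hs n i j refl | false | just (just t) | just nothing =
  meld-≼ w hs n i j (just t) i≢j eˣ eʸ
    (≼-respʳ (⊕-comm (pot 8 1 1) (heapPot w (just t))) (const-⊕-mono-≼ {1} {8} (heapPot w (just t)) (s≤s z≤n)))
step-meld-≼ w hs n i j refl | false | just (just t₁) | just (just t₂) =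
  meld-≼ w hs n i j (just (pair t₁ t₂)) i≢j eˣ eʸ (pair-≼ w t₁ t₂)

lemma3 : (pre post : List Op) (h₁ h₂ : ℕ) (s₀ s₁ sₘ : State) (a : ℕ) →
    run initial pre ≡ just s₀ →
    step s₀ (meld h₁ h₂) ≡ just (s₁ , a) →
    run s₁ post ≡ just sₘ →
    addInt a (Φ (whiteIn sₘ) s₁) ⊑ Φ (whiteIn sₘ) s₀
-- The bound holds for every colouring and every collection.
lemma3 pre post h₁ h₂ (st hs n) s₁ sₘ a _ meld-step _ = ≼-unwrap (step-meld-≼ (whiteIn sₘ) hs n h₁ h₂ meld-step)
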